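{- Let $F$ be a rooted forest and let $B$ be a complete graph on at least $v(F)+e(F)$ vertices, all edges initially free, with distinct images of the roots of $F$ fixed at the beginning. Then, in the Waiter-Client game on $B$, Waiter can force a red copy $\bar F$ of $F$ within at most $e(F)$ rounds in such a way that (a) all roots are mapped to the vertices fixed at the beginning; (b) every colored edge has an endpoint in a non-leaf of $\bar F$; (c) all blue edges between $V(\bar F)$ and $V(B)\setminus V(\bar F)$ form a star forest such that every star is centered at a vertex $u\in V(\bar F)$ and has at most $\deg_{\bar F}(u)$ edges.
   Context: A rooted forest is a forest in which each component has exactly one distinguished vertex, its root. A leaf of a rooted forest is a vertex of degree 1 which is not a root (roots are never leaves). Waiter-Client game on $B$: in each round Waiter offers two free edges, Client colors one red (his) and the other becomes blue (Waiter's); an edge is colored if red or blue. Waiter forces a graph within $t$ rounds if she can ensure the red graph contains a copy of it after at most $t$ rounds. -}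

module Defs where

open import Data.Nat using (ℕ; zero; suc; _+_; _≤_; _<_)
open import Data.Fin using (Fin; toℕ)
open import Data.Fin.Properties using (_≟_)
open import Data.Maybe using (Maybe; just; nothing)
import Data.Maybe.Properties as MP
open import Data.List using (List; []; _∷_; _++_; length; filter; allFin)
open import Data.List.Membership.Propositional using (_∈_)
open import Data.List.Relation.Unary.Any using (Any)
open import Data.Product using (Σ; ∃; _×_; _,_; proj₁; proj₂)
open import Data.Sum using (_⊎_)
open import Relation.Nullary using (¬_; Dec)
open import Relation.Binary.PropositionalEquality using (_≡_; _≢_)

-- A vertex with parent ≡ nothing is a root (one per component); the
-- edges of the forest are {i , p} whenever parent i ≡ just p.
-- Acyclicity is guaranteed by requiring parents to have smaller index
-- (every rooted forest admits such a labelling).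

record RootedForest (n : ℕ) : Set where
  field
    parent    : Fin n → Maybe (Fin n)
    parent-lt : ∀ i j → parent i ≡ just j → toℕ j < toℕ i

module _ {n : ℕ} (F : RootedForest n) where
  open RootedForest F

  IsRoot : Fin n → Set
  IsRoot i = parent i ≡ nothing

  vF : ℕ
  vF = n

  -- e(F) = number of non-root vertices (= number of parent edges)
  eF : ℕ
  eF = length (filter (λ i → ¬? (MP.≡-dec _≟_ (parent i) nothing)) (allFin n))
    where open import Relation.Nullary.Decidable using (¬?)

  children : Fin n → ℕ
  children k = length (filter (λ j → MP.≡-dec _≟_ (parent j) (just k)) (allFin n))

  deg : Fin n → ℕ
  deg k with parent k
  ... | just _  = suc (children k)
  ... | nothing = children k

  Leaf : Fin n → Set
  Leaf k = ¬ IsRoot k × deg k ≡ 1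

  NonLeaf : Fin n → Set
  NonLeaf k = ¬ Leaf k

-- The board: complete graph on Fin N.  An edge is an ordered pair of
-- distinct vertices, considered up to swapping.

Pair : ℕ → Set
Pair N = Fin N × Fin N

SameEdge : ∀ {N} → Pair N → Pair N → Set
SameEdge (a , b) (c , d) = (a ≡ c × b ≡ d) ⊎ (a ≡ d × b ≡ c)

IsEdge : ∀ {N} → Pair N → Set
IsEdge (a , b) = a ≢ b

_∈E_ : ∀ {N} → Pair N → List (Pair N) → Set
e ∈E es = Any (SameEdge e) es

record Colouring (N : ℕ) : Set where
  constructor col
  field
    red  : List (Pair N)
    blue : List (Pair N)
open Colouring public

Free : ∀ {N} → Pair N → Colouring N → Set
Free e c = ¬ (e ∈E red c) × ¬ (e ∈E blue c)

pick : ∀ {N} → (r b : Pair N) → Colouring N → Colouring N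
pick r b (col R B) = col (r ∷ R) (b ∷ B)

-- WaiterForces P t c : from colouring c, Waiter can ensure that after at
-- most t further rounds the colouring satisfies P, whatever Client does.
data WaiterForces {N : ℕ} (P : Colouring N → Set) : ℕ → Colouring N → Set where
  stop  : ∀ {t c} → P c → WaiterForces P t c
  offer : ∀ {t c} (e₁ e₂ : Pair N) →
          IsEdge e₁ → IsEdge e₂ → ¬ SameEdge e₁ e₂ →
          Free e₁ c → Free e₂ c →
          WaiterForces P t (pick e₁ e₂ c) →
          WaiterForces P t (pick e₂ e₁ c) →
          WaiterForces P (suc t) c

emptyColouring : ∀ {N} → Colouring N
emptyColouring = col [] []

module _ {n N : ℕ} (F : RootedForest n) (ρ : Fin n → Fin N) where
  open RootedForest F

  InImage : (Fin n → Fin N) → Fin N → Set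
  InImage φ v = ∃ λ k → φ k ≡ v

  blueOut : (φ : Fin n → Fin N) → Colouring N → Fin N → ℕ
  blueOut φ c u = length (filter dec (allFin N))
    where
      open import Relation.Nullary.Decidable using (_×-dec_; ¬?)
      open import Data.List.Relation.Unary.Any using (any?)
      open import Data.Fin.Properties using ()
        renaming (any? to anyFin?)
      open import Data.Sum using (inj₁; inj₂)
      open import Relation.Nullary.Decidable using (_⊎-dec_)
      sameDec : (e f : Pair N) → Dec (SameEdge e f)
      sameDec (a , b) (x , y) = ((a ≟ x) ×-dec (b ≟ y)) ⊎-dec ((a ≟ y) ×-dec (b ≟ x))
      dec : (w : Fin N) → Dec (¬ InImage φ w × (u , w) ∈E blue c)
      dec w = ¬? (anyFin? (λ k → φ k ≟ w)) ×-dec any? (sameDec (u , w)) (blue c)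

  GoodCopy : Colouring N → Set
  GoodCopy c = Σ (Fin n → Fin N) λ φ →
      (∀ i j → φ i ≡ φ j → i ≡ j)
    × (∀ i j → parent i ≡ just j → (φ i , φ j) ∈E red c)
    × (∀ i → IsRoot F i → φ i ≡ ρ i)
    × (∀ e → e ∈ (red c ++ blue c) →
         ∃ λ k → NonLeaf F k × (φ k ≡ proj₁ e ⊎ φ k ≡ proj₂ e))
      -- (c) blue edges between V(F̄) and V(B)∖V(F̄) form a star forest
      --     whose stars are centred at vertices φ k of F̄:
      --     each outside vertex meets at most one such edge, ...
    × (∀ w → ¬ InImage φ w → ∀ k k' →
         (φ k , w) ∈E blue c → (φ k' , w) ∈E blue c → k ≡ k')
      --     ... and the star at φ k has at most deg_F̄(φ k) = deg_F(k) edges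
    × (∀ k → blueOut φ c (φ k) ≤ deg F k)

{-# OPTIONS --safe #-}
module Submission where

-- Waiter embeds F vertex by vertex in increasing index order, so the parent p
-- of the next non-root x is already mapped to ψ p.  She picks two board
-- vertices r, b not touched so far and offers the edges {ψ p, r} and {ψ p, b};
-- x is mapped to the endpoint of the edge Client colours red, and the blue
-- endpoint is never touched again.  Hence every coloured edge starts at the
-- image of a vertex with a child, i.e. of a non-leaf; each blue edge leaving
-- the copy ends at its own private vertex; and the blue star at ψ p has one
-- edge per child of p.  Each non-root costs one round and two fresh vertices,
-- and the v(F) − e(F) root images plus these 2 e(F) vertices fit on the board.

open import Defs
open import Data.Empty using (⊥-elim)
open import Data.Fin using (Fin; toℕ)
open import Data.Fin.Properties using (_≟_; ¬∀⟶∃¬)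
open import Data.List using (List; []; _∷_; _++_; [_]; _∷ʳ_; length; filter; allFin; map)
open import Data.List.Membership.Propositional using (_∈_; _∉_; find)
open import Data.List.Membership.Propositional.Properties
  using (∈-allFin; ∈-++⁻; ∈-++⁺ˡ; ∈-++⁺ʳ; ∈-map⁺; ∈-filter⁺; ∈-filter⁻; ∈-∃++)
open import Data.List.Properties
  using ( filter-++; filter-accept; filter-none; filter-some
        ; length-++; length-map; length-tabulate; ++-assoc; ++-identityʳ)
open import Data.List.Relation.Binary.Permutation.Propositional.Properties using (↭-length; shift)
open import Data.List.Relation.Binary.Subset.Propositional using (_⊆_)
open import Data.List.Relation.Unary.All as All using (All; []; _∷_)
import Data.List.Relation.Unary.All.Properties as All
import Data.List.Relation.Unary.Any as Any
open import Data.List.Relation.Unary.Any using (here; there)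
open import Data.List.Relation.Unary.AllPairs using (AllPairs; _∷_)
open import Data.List.Relation.Unary.AllPairs.Properties using (tabulate⁺-<)
open import Data.List.Relation.Unary.Unique.Propositional using (Unique)
import Data.List.Relation.Unary.Unique.Propositional.Properties as Unique
open import Data.Maybe using (just; nothing)
import Data.Maybe.Properties as Maybe
open import Data.Nat using (ℕ; suc; _+_; _*_; _≤_; _<_; z≤n; s≤s)
open import Data.Nat.Properties
  using ( ≤-refl; ≤-trans; n≤1+n; m≤m+n; m≤n+m; m+n≤o⇒m≤o; +-suc; +-comm; suc-injective
        ; <-irrefl; <-asym; <-trans; <⇒≱; module ≤-Reasoning)
open import Data.Nat.Tactic.RingSolver using (solve-∀)
open import Data.Product using (∃; ∃₂; _×_; _,_; proj₁; proj₂)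
open import Data.Sum using (_⊎_; inj₁; inj₂)
open import Data.Vec.Functional using (updateAt)
open import Data.Vec.Functional.Properties using (updateAt-updates; updateAt-minimal)
open import Function using (_∘_; const; case_of_)
open import Relation.Binary.PropositionalEquality
  using (_≡_; _≢_; refl; sym; trans; cong; cong₂; subst; module ≡-Reasoning)
open import Relation.Nullary using (¬_; yes; no)
open import Relation.Nullary.Decidable using (¬?)
open import Relation.Unary using (Decidable)

module _ {A : Set} where

  Unique-⊆⇒length≤ : {xs ys : List A} → Unique xs → xs ⊆ ys → length xs ≤ length ys
  Unique-⊆⇒length≤ {[]} _ _ = z≤n
  Unique-⊆⇒length≤ {x ∷ xs} (x∉xs ∷ unique) xs⊆ys with ∈-∃++ (xs⊆ys (here refl))
  ... | ys₁ , ys₂ , refl = begin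
      suc (length xs)            ≤⟨ s≤s (Unique-⊆⇒length≤ unique xs⊆ys₁++ys₂) ⟩
      suc (length (ys₁ ++ ys₂))  ≡⟨ ↭-length (shift x ys₁ ys₂) ⟨
      length (ys₁ ++ x ∷ ys₂)    ∎
    where
      open ≤-Reasoning
      xs⊆ys₁++ys₂ : xs ⊆ ys₁ ++ ys₂
      xs⊆ys₁++ys₂ y∈xs with ∈-++⁻ ys₁ (xs⊆ys (there y∈xs))
      ... | inj₁ y∈ys₁          = ∈-++⁺ˡ y∈ys₁
      ... | inj₂ (here refl)    = ⊥-elim (All.lookup x∉xs y∈xs refl)
      ... | inj₂ (there y∈ys₂)  = ∈-++⁺ʳ ys₁ y∈ys₂

  AllPairs-++-∷⁻ : ∀ {R : A → A → Set} pre {x xs} → AllPairs R (pre ++ x ∷ xs) →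
                   All (λ i → R i x) pre × All (R x) xs
  AllPairs-++-∷⁻ []        (Rx ∷ _)      = [] , Rx
  AllPairs-++-∷⁻ (_ ∷ pre) (Ri ∷ sorted) with AllPairs-++-∷⁻ pre sorted
  ... | below , above = All.lookup Ri (∈-++⁺ʳ pre (here refl)) ∷ below , above

  length-filter-++ : ∀ {P : A → Set} (P? : Decidable P) xs ys →
                     length (filter P? (xs ++ ys)) ≡ length (filter P? xs) + length (filter P? ys)
  length-filter-++ P? xs ys = trans (cong length (filter-++ P? xs ys)) (length-++ (filter P? xs))

∃-∉ : ∀ {N} (U : List (Fin N)) → length U < N → ∃ λ a → a ∉ U
∃-∉ {N} U |U|<N = ¬∀⟶∃¬ N (_∈ U) (λ a → Any.any? (a ≟_) U) λ U-covers →
  <⇒≱ |U|<N (subst (_≤ length U) (length-tabulate (λ a → a))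
                (Unique-⊆⇒length≤ (Unique.allFin⁺ N) (λ {a} _ → U-covers a)))

∃-fresh-pair : ∀ {N} (U : List (Fin N)) → 2 + length U ≤ N → ∃₂ λ a b → a ∉ U × b ∉ U × a ≢ b
∃-fresh-pair U 2+|U|≤N with ∃-∉ U (≤-trans (n≤1+n _) 2+|U|≤N)
... | a , a∉U with ∃-∉ (a ∷ U) 2+|U|≤N
... | b , b∉a∷U = a , b , a∉U , b∉a∷U ∘ there , λ a≡b → b∉a∷U (here (sym a≡b))

module _ {N : ℕ} where

  EndsIn : List (Fin N) → Pair N → Set
  EndsIn U e = proj₁ e ∈ U × proj₂ e ∈ U

  outdeg : Fin N → List (Pair N) → ℕ
  outdeg u es = length (filter (λ e → proj₁ e ≟ u) es)

  outdeg-∉ : ∀ {U a} {es : List (Pair N)} → All (λ e → proj₁ e ∈ U) es → a ∉ U → outdeg a es ≡ 0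
  outdeg-∉ {U} starts a∉U =
    cong length (filter-none _ (All.map (λ u∈U u≡a → a∉U (subst (_∈ U) u≡a u∈U)) starts))

  fresh-endpoint⇒∉E : ∀ {U a u} {es : List (Pair N)} → All (EndsIn U) es → a ∉ U → ¬ (u , a) ∈E es
  fresh-endpoint⇒∉E {U} ends a∉U u-a∈es with find u-a∈es
  ... | (_ , _) , e∈es , inj₁ (_ , a≡) = a∉U (subst (_∈ U) (sym a≡) (proj₂ (All.lookup ends e∈es)))
  ... | (_ , _) , e∈es , inj₂ (_ , a≡) = a∉U (subst (_∈ U) (sym a≡) (proj₁ (All.lookup ends e∈es)))

  forces-weaken : ∀ {P : Colouring N → Set} {s t c} → s ≤ t → WaiterForces P s c → WaiterForces P t c
  forces-weaken _         (stop p) = stop p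
  forces-weaken (s≤s s≤t) (offer e₁ e₂ edge₁ edge₂ e₁≉e₂ free₁ free₂ play₁ play₂) =
    offer e₁ e₂ edge₁ edge₂ e₁≉e₂ free₁ free₂ (forces-weaken s≤t play₁) (forces-weaken s≤t play₂)

  forces-bind : ∀ {P Q : Colouring N → Set} {s t c} → WaiterForces P s c →
                (∀ {c′} → P c′ → WaiterForces Q t c′) → WaiterForces Q (s + t) c
  forces-bind {s = s} {t} (stop p) continue = forces-weaken (m≤n+m t s) (continue p)
  forces-bind (offer e₁ e₂ edge₁ edge₂ e₁≉e₂ free₁ free₂ play₁ play₂) continue =
    offer e₁ e₂ edge₁ edge₂ e₁≉e₂ free₁ free₂ (forces-bind play₁ continue) (forces-bind play₂ continue)

module Forest {n : ℕ} (F : RootedForest n) where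
  open RootedForest F

  isRoot? : Decidable (IsRoot F)
  isRoot? i = Maybe.≡-dec _≟_ (parent i) nothing

  nonRoot? : Decidable (λ i → ¬ IsRoot F i)
  nonRoot? i = ¬? (isRoot? i)

  nonRoots : List (Fin n) → ℕ
  nonRoots xs = length (filter nonRoot? xs)

  roots+nonRoots : ∀ xs → length (filter isRoot? xs) + nonRoots xs ≡ length xs
  roots+nonRoots []       = refl
  roots+nonRoots (x ∷ xs) with isRoot? x
  ... | yes _ = cong suc (roots+nonRoots xs)
  ... | no _  = trans (+-suc _ _) (cong suc (roots+nonRoots xs))

  nonRoot⇒∃parent : ∀ {i} → ¬ IsRoot F i → ∃ λ p → parent i ≡ just p
  nonRoot⇒∃parent {i} nonRoot with parent i
  ... | just p  = p , refl
  ... | nothing = ⊥-elim (nonRoot refl)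

  childOf? : (k : Fin n) → Decidable (λ j → parent j ≡ just k)
  childOf? k j = Maybe.≡-dec _≟_ (parent j) (just k)

  childrenIn : Fin n → List (Fin n) → ℕ
  childrenIn k xs = length (filter (childOf? k) xs)

  childrenIn-∷ʳ-child : ∀ {k x} xs → parent x ≡ just k → childrenIn k (xs ∷ʳ x) ≡ suc (childrenIn k xs)
  childrenIn-∷ʳ-child {k} {x} xs x-child = begin
    childrenIn k (xs ∷ʳ x)                               ≡⟨ length-filter-++ (childOf? k) xs [ x ] ⟩
    childrenIn k xs + length (filter (childOf? k) [ x ]) ≡⟨ cong (λ ys → childrenIn k xs + length ys)
                                                                 (filter-accept (childOf? k) x-child) ⟩
    childrenIn k xs + 1                                  ≡⟨ +-comm _ 1 ⟩
    suc (childrenIn k xs)                                ∎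
    where open ≡-Reasoning

  childrenIn-∷ʳ : ∀ {k} xs x → childrenIn k xs ≤ childrenIn k (xs ∷ʳ x)
  childrenIn-∷ʳ {k} xs x = subst (childrenIn k xs ≤_) (sym (length-filter-++ (childOf? k) xs [ x ])) (m≤m+n _ _)

  children≤deg : ∀ k → children F k ≤ deg F k
  children≤deg k with parent k
  ... | just _  = n≤1+n _
  ... | nothing = ≤-refl

  HasChild : Fin n → Set
  HasChild k = ∃ λ j → parent j ≡ just k

  hasChild⇒nonLeaf : ∀ {k} → HasChild k → NonLeaf F k
  hasChild⇒nonLeaf {k} (j , j-child) (nonRoot , deg≡1) with parent k
  ... | nothing = nonRoot refl
  ... | just _  = <-irrefl (sym (suc-injective deg≡1))
                    (filter-some (childOf? k) (Any.map (λ { refl → j-child }) (∈-allFin j)))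

  Dom : List (Fin n) → Fin n → Set
  Dom pre j = j ∈ pre ⊎ IsRoot F j

  Dom-∷ʳ⁺ : ∀ {pre x j} → Dom pre j → Dom (pre ∷ʳ x) j
  Dom-∷ʳ⁺ (inj₁ j∈pre) = inj₁ (∈-++⁺ˡ j∈pre)
  Dom-∷ʳ⁺ (inj₂ root)  = inj₂ root

  Dom-∷ʳ⁻ : ∀ {pre x j} → Dom (pre ∷ʳ x) j → j ≡ x ⊎ Dom pre j
  Dom-∷ʳ⁻ {pre} (inj₁ j∈pre∷ʳx) with ∈-++⁻ pre j∈pre∷ʳx
  ... | inj₁ j∈pre       = inj₂ (inj₁ j∈pre)
  ... | inj₂ (here j≡x)  = inj₁ j≡x
  Dom-∷ʳ⁻ (inj₂ root) = inj₂ (inj₂ root)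

  module Prefix {pre x xs} (split : pre ++ x ∷ xs ≡ allFin n) where

    pre<x<xs : All (λ i → toℕ i < toℕ x) pre × All (λ j → toℕ x < toℕ j) xs
    pre<x<xs = AllPairs-++-∷⁻ pre (subst (AllPairs _) (sym split) (tabulate⁺-< (λ i<j → i<j)))

    x∉pre : x ∉ pre
    x∉pre x∈pre = <-irrefl refl (All.lookup (proj₁ pre<x<xs) x∈pre)

    below⇒∈pre : ∀ {j} → toℕ j < toℕ x → j ∈ pre
    below⇒∈pre {j} j<x with ∈-++⁻ pre (subst (j ∈_) (sym split) (∈-allFin j))
    ... | inj₁ j∈pre          = j∈pre
    ... | inj₂ (here refl)    = ⊥-elim (<-irrefl refl j<x)
    ... | inj₂ (there j∈xs)   = ⊥-elim (<-asym j<x (All.lookup (proj₂ pre<x<xs) j∈xs))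

    parent∈pre : ∀ {p} → parent x ≡ just p → p ∈ pre
    parent∈pre {p} x-child = below⇒∈pre (parent-lt x p x-child)

    pre-closed : ∀ {i p} → i ∈ pre → parent i ≡ just p → p ∈ pre
    pre-closed {i} {p} i∈pre i-child =
      below⇒∈pre (<-trans (parent-lt i p i-child) (All.lookup (proj₁ pre<x<xs) i∈pre))

    Dom⇒≢ : ¬ IsRoot F x → ∀ {j} → Dom pre j → j ≢ x
    Dom⇒≢ _       (inj₁ j∈pre) refl = x∉pre j∈pre
    Dom⇒≢ nonRoot (inj₂ root)  refl = nonRoot root

module Strategy {n : ℕ} (F : RootedForest n) {N : ℕ} (ρ : Fin n → Fin N) where
  open RootedForest F
  open Forest F

  ParentImage : List (Fin n) → (Fin n → Fin N) → Fin N → Set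
  ParentImage pre ψ u = ∃ λ k → Dom pre k × HasChild k × ψ k ≡ u

  record PartialCopy (pre todo : List (Fin n)) (c : Colouring N) : Set where
    field
      ψ               : Fin n → Fin N
      used            : List (Fin N)
      split           : pre ++ todo ≡ allFin n
      budget          : length used + 2 * nonRoots todo ≤ N
      ψ-root          : ∀ i → IsRoot F i → ψ i ≡ ρ i
      ψ-injective     : ∀ {i j} → Dom pre i → Dom pre j → ψ i ≡ ψ j → i ≡ j
      ψ-used          : ∀ {i} → Dom pre i → ψ i ∈ used
      red-tree        : ∀ {i p} → i ∈ pre → parent i ≡ just p → (ψ p , ψ i) ∈ red c
      red-source      : All (ParentImage pre ψ ∘ proj₁) (red c)
      blue-source     : All (ParentImage pre ψ ∘ proj₁) (blue c)
      red-used        : All (EndsIn used) (red c)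
      blue-used       : All (EndsIn used) (blue c)
      blue-functional : ∀ {e e′} → e ∈ blue c → e′ ∈ blue c → proj₂ e ≡ proj₂ e′ → proj₁ e ≡ proj₁ e′
      blue-outdeg     : ∀ {k} → Dom pre k → outdeg (ψ k) (blue c) ≤ childrenIn k pre

  ParentImage-∷ʳ : ∀ {pre x} {ψ ψ′ : Fin n → Fin N} → (∀ {k} → Dom pre k → ψ′ k ≡ ψ k) →
                   ∀ {u} → ParentImage pre ψ u → ParentImage (pre ∷ʳ x) ψ′ u
  ParentImage-∷ʳ ψ′≗ψ (k , k∈ , hasChild , ψk≡) = k , Dom-∷ʳ⁺ k∈ , hasChild , trans (ψ′≗ψ k∈) ψk≡

  budget-root : ∀ {x xs u} → IsRoot F x → u + 2 * nonRoots (x ∷ xs) ≤ N → u + 2 * nonRoots xs ≤ N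
  budget-root {x} root fits with isRoot? x
  ... | yes _      = fits
  ... | no nonRoot = ⊥-elim (nonRoot root)

  budget-nonRoot : ∀ {x xs u} → ¬ IsRoot F x → u + 2 * nonRoots (x ∷ xs) ≤ N → 2 + u + 2 * nonRoots xs ≤ N
  budget-nonRoot {x} {xs} {u} nonRoot fits with isRoot? x
  ... | yes root = ⊥-elim (nonRoot root)
  ... | no _     = subst (_≤ N) (sym (two-more u (nonRoots xs))) fits
    where
      two-more : ∀ u t → 2 + u + 2 * t ≡ u + 2 * suc t
      two-more = solve-∀

  initial : vF F + eF F ≤ N → (∀ i j → IsRoot F i → IsRoot F j → ρ i ≡ ρ j → i ≡ j) →
            PartialCopy [] (allFin n) emptyColouring
  initial fits ρ-injective = record
    { ψ               = ρ
    ; used            = map ρ roots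
    ; split           = refl
    ; budget          = subst (_≤ N) room fits
    ; ψ-root          = λ _ _ → refl
    ; ψ-injective     = roots-injective
    ; ψ-used          = ρ-used
    ; red-tree        = λ ()
    ; red-source      = []
    ; blue-source     = []
    ; red-used        = []
    ; blue-used       = []
    ; blue-functional = λ ()
    ; blue-outdeg     = λ _ → z≤n
    }
    where
      roots : List (Fin n)
      roots = filter isRoot? (allFin n)

      room : n + eF F ≡ length (map ρ roots) + 2 * eF F
      room = begin
        n + eF F                        ≡⟨ cong (_+ eF F) (length-tabulate (λ i → i)) ⟨
        length (allFin n) + eF F        ≡⟨ cong (_+ eF F) (roots+nonRoots (allFin n)) ⟨
        length roots + eF F + eF F      ≡⟨ twice (length roots) (eF F) ⟩
        length roots + 2 * eF F         ≡⟨ cong (_+ 2 * eF F) (length-map ρ roots) ⟨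
        length (map ρ roots) + 2 * eF F ∎
        where
          open ≡-Reasoning
          twice : ∀ r e → r + e + e ≡ r + 2 * e
          twice = solve-∀

      roots-injective : ∀ {i j} → Dom [] i → Dom [] j → ρ i ≡ ρ j → i ≡ j
      roots-injective (inj₂ i-root) (inj₂ j-root) = ρ-injective _ _ i-root j-root

      ρ-used : ∀ {i} → Dom [] i → ρ i ∈ map ρ roots
      ρ-used (inj₂ i-root) = ∈-map⁺ ρ (∈-filter⁺ isRoot? (∈-allFin _) i-root)

  extendByRoot : ∀ {pre x xs c} → PartialCopy pre (x ∷ xs) c → IsRoot F x → PartialCopy (pre ∷ʳ x) xs c
  extendByRoot {pre} {x} {xs} {c} inv root = record
    { ψ               = ψ
    ; used            = used
    ; split           = trans (++-assoc pre [ x ] xs) split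
    ; budget          = budget-root {xs = xs} {u = length used} root budget
    ; ψ-root          = ψ-root
    ; ψ-injective     = λ i∈ j∈ → ψ-injective (shrink i∈) (shrink j∈)
    ; ψ-used          = ψ-used ∘ shrink
    ; red-tree        = red-tree′
    ; red-source      = All.map (ParentImage-∷ʳ {x = x} (λ _ → refl)) red-source
    ; blue-source     = All.map (ParentImage-∷ʳ {x = x} (λ _ → refl)) blue-source
    ; red-used        = red-used
    ; blue-used       = blue-used
    ; blue-functional = blue-functional
    ; blue-outdeg     = λ k∈ → ≤-trans (blue-outdeg (shrink k∈)) (childrenIn-∷ʳ pre x)
    }
    where
      open PartialCopy inv

      shrink : ∀ {j} → Dom (pre ∷ʳ x) j → Dom pre j
      shrink j∈ with Dom-∷ʳ⁻ j∈
      ... | inj₁ refl = inj₂ root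
      ... | inj₂ j∈pre = j∈pre

      red-tree′ : ∀ {i p} → i ∈ pre ∷ʳ x → parent i ≡ just p → (ψ p , ψ i) ∈ red c
      red-tree′ i∈ i-child with ∈-++⁻ pre i∈
      ... | inj₁ i∈pre        = red-tree i∈pre i-child
      ... | inj₂ (here refl)  with trans (sym root) i-child
      ... | ()

  module Extend {pre x xs c} (inv : PartialCopy pre (x ∷ xs) c) {p} (x-child : parent x ≡ just p) where
    open PartialCopy inv
    open Prefix split

    x-nonRoot : ¬ IsRoot F x
    x-nonRoot root = case trans (sym root) x-child of λ ()

    p∈ : Dom pre p
    p∈ = inj₁ (parent∈pre x-child)

    ψp-used : ψ p ∈ used
    ψp-used = ψ-used p∈

    ∉used⇒≢ψ : ∀ {a j} → a ∉ used → Dom pre j → ψ j ≢ a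
    ∉used⇒≢ψ a∉used j∈ ψj≡a = a∉used (subst (_∈ used) ψj≡a (ψ-used j∈))

    module _ {r b} (r∉used : r ∉ used) (b∉used : b ∉ used) where

      ψ′ : Fin n → Fin N
      ψ′ = updateAt ψ x (const r)

      ψ′-new : ψ′ x ≡ r
      ψ′-new = updateAt-updates x ψ

      ψ′-old : ∀ {j} → Dom pre j → ψ′ j ≡ ψ j
      ψ′-old {j} j∈ = updateAt-minimal j x ψ (Dom⇒≢ x-nonRoot j∈)

      red′ blue′ : List (Pair N)
      red′  = (ψ p , r) ∷ red c
      blue′ = (ψ p , b) ∷ blue c

      used′ : List (Fin N)
      used′ = r ∷ b ∷ used

      new≢old : ∀ {j} → Dom pre j → ψ′ x ≢ ψ′ j
      new≢old j∈old ψ′x≡ψ′j = ∉used⇒≢ψ r∉used j∈old (trans (sym (ψ′-old j∈old)) (trans (sym ψ′x≡ψ′j) ψ′-new))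

      ψ′-injective : ∀ {i j} → Dom (pre ∷ʳ x) i → Dom (pre ∷ʳ x) j → ψ′ i ≡ ψ′ j → i ≡ j
      ψ′-injective i∈ j∈ same with Dom-∷ʳ⁻ i∈ | Dom-∷ʳ⁻ j∈
      ... | inj₁ refl   | inj₁ refl   = refl
      ... | inj₁ refl   | inj₂ j∈old = ⊥-elim (new≢old j∈old same)
      ... | inj₂ i∈old | inj₁ refl   = ⊥-elim (new≢old i∈old (sym same))
      ... | inj₂ i∈old | inj₂ j∈old =
        ψ-injective i∈old j∈old (trans (sym (ψ′-old i∈old)) (trans same (ψ′-old j∈old)))

      ψ′-used : ∀ {i} → Dom (pre ∷ʳ x) i → ψ′ i ∈ used′
      ψ′-used i∈ with Dom-∷ʳ⁻ i∈
      ... | inj₁ refl  = here ψ′-new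
      ... | inj₂ i∈old = there (there (subst (_∈ used) (sym (ψ′-old i∈old)) (ψ-used i∈old)))

      red-tree′ : ∀ {i q} → i ∈ pre ∷ʳ x → parent i ≡ just q → (ψ′ q , ψ′ i) ∈ red′
      red-tree′ i∈ i-child with ∈-++⁻ pre i∈
      ... | inj₁ i∈pre = there (subst (_∈ red c)
        (sym (cong₂ _,_ (ψ′-old (inj₁ (pre-closed i∈pre i-child))) (ψ′-old (inj₁ i∈pre))))
        (red-tree i∈pre i-child))
      ... | inj₂ (here refl) with refl ← trans (sym x-child) i-child =
        here (cong₂ _,_ (ψ′-old p∈) ψ′-new)

      p-image : ParentImage (pre ∷ʳ x) ψ′ (ψ p)
      p-image = p , Dom-∷ʳ⁺ p∈ , (x , x-child) , ψ′-old p∈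

      grow : ∀ {u} → ParentImage pre ψ u → ParentImage (pre ∷ʳ x) ψ′ u
      grow = ParentImage-∷ʳ ψ′-old

      EndsIn-used′ : ∀ {e} → EndsIn used e → EndsIn used′ e
      EndsIn-used′ (u∈ , v∈) = there (there u∈) , there (there v∈)

      old≢b : ∀ {e} → e ∈ blue c → proj₂ e ≢ b
      old≢b e∈ ≡b = b∉used (subst (_∈ used) ≡b (proj₂ (All.lookup blue-used e∈)))

      blue-functional′ : ∀ {e e′} → e ∈ blue′ → e′ ∈ blue′ → proj₂ e ≡ proj₂ e′ → proj₁ e ≡ proj₁ e′
      blue-functional′ (here refl) (here refl) _  = refl
      blue-functional′ (here refl) (there e′∈) b≡ = ⊥-elim (old≢b e′∈ (sym b≡))
      blue-functional′ (there e∈)  (here refl) ≡b = ⊥-elim (old≢b e∈ ≡b)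
      blue-functional′ (there e∈)  (there e′∈) ≡₂ = blue-functional e∈ e′∈ ≡₂

      old-outdeg : ∀ {k} → Dom pre k → outdeg (ψ k) blue′ ≤ childrenIn k (pre ∷ʳ x)
      old-outdeg {k} k∈old with ψ p ≟ ψ k
      ... | yes ψp≡ψk with refl ← ψ-injective p∈ k∈old ψp≡ψk =
        subst (_ ≤_) (sym (childrenIn-∷ʳ-child pre x-child)) (s≤s (blue-outdeg k∈old))
      ... | no _ = ≤-trans (blue-outdeg k∈old) (childrenIn-∷ʳ pre x)

      new-outdeg : outdeg r blue′ ≡ 0
      new-outdeg = outdeg-∉ (ψp-used ∷ All.map proj₁ blue-used) r∉used

      blue-outdeg′ : ∀ {k} → Dom (pre ∷ʳ x) k → outdeg (ψ′ k) blue′ ≤ childrenIn k (pre ∷ʳ x)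
      blue-outdeg′ k∈ with Dom-∷ʳ⁻ k∈
      ... | inj₁ refl  = subst (_≤ _) (sym (trans (cong (λ u → outdeg u blue′) ψ′-new) new-outdeg)) z≤n
      ... | inj₂ k∈old = subst (_≤ _) (cong (λ u → outdeg u blue′) (sym (ψ′-old k∈old))) (old-outdeg k∈old)

      extended : PartialCopy (pre ∷ʳ x) xs (pick (ψ p , r) (ψ p , b) c)
      extended = record
        { ψ               = ψ′
        ; used            = used′
        ; split           = trans (++-assoc pre [ x ] xs) split
        ; budget          = budget-nonRoot {xs = xs} {u = length used} x-nonRoot budget
        ; ψ-root          = λ i root → trans (ψ′-old (inj₂ root)) (ψ-root i root)
        ; ψ-injective     = ψ′-injective
        ; ψ-used          = ψ′-used
        ; red-tree        = red-tree′
        ; red-source      = p-image ∷ All.map grow red-source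
        ; blue-source     = p-image ∷ All.map grow blue-source
        ; red-used        = (there (there ψp-used) , here refl) ∷ All.map EndsIn-used′ red-used
        ; blue-used       = (there (there ψp-used) , there (here refl)) ∷ All.map EndsIn-used′ blue-used
        ; blue-functional = blue-functional′
        ; blue-outdeg     = blue-outdeg′
        }

    r≉b : ∀ {r b} → b ∉ used → r ≢ b → ¬ SameEdge (ψ p , r) (ψ p , b)
    r≉b _      r≢b (inj₁ (_ , r≡b))  = r≢b r≡b
    r≉b b∉used _   (inj₂ (ψp≡b , _)) = ∉used⇒≢ψ b∉used p∈ ψp≡b

    free : ∀ {a} → a ∉ used → Free (ψ p , a) c
    free a∉used = fresh-endpoint⇒∉E red-used a∉used , fresh-endpoint⇒∉E blue-used a∉used

    round : WaiterForces (PartialCopy (pre ∷ʳ x) xs) 1 c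
    round with ∃-fresh-pair used (m+n≤o⇒m≤o _ (budget-nonRoot {xs = xs} {u = length used} x-nonRoot budget))
    ... | r , b , r∉used , b∉used , r≢b =
      offer (ψ p , r) (ψ p , b) (∉used⇒≢ψ r∉used p∈) (∉used⇒≢ψ b∉used p∈)
            (r≉b b∉used r≢b) (free r∉used) (free b∉used)
            (stop (extended r∉used b∉used)) (stop (extended b∉used r∉used))

  module Complete {c} (inv : PartialCopy (allFin n) [] c) where
    open PartialCopy inv

    dom : ∀ j → Dom (allFin n) j
    dom j = inj₁ (∈-allFin j)

    coloured-at-nonLeaf : ∀ e → e ∈ red c ++ blue c →
                          ∃ λ k → NonLeaf F k × (ψ k ≡ proj₁ e ⊎ ψ k ≡ proj₂ e)
    coloured-at-nonLeaf e e∈ with All.lookup (All.++⁺ red-source blue-source) e∈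
    ... | k , _ , hasChild , ψk≡ = k , hasChild⇒nonLeaf hasChild , inj₁ ψk≡

    blue-leaving : ∀ {k w} → ¬ InImage F ρ ψ w → (ψ k , w) ∈E blue c → (ψ k , w) ∈ blue c
    blue-leaving w∉image ψk-w∈ with find ψk-w∈
    ... | (_ , _) , e∈ , inj₁ (refl , refl) = e∈
    ... | (_ , _) , e∈ , inj₂ (_ , w≡u) with All.lookup blue-source e∈
    ...   | k′ , _ , _ , ψk′≡u = ⊥-elim (w∉image (k′ , trans ψk′≡u (sym w≡u)))

    blue-star-disjoint : ∀ w → ¬ InImage F ρ ψ w → ∀ k k′ →
                         (ψ k , w) ∈E blue c → (ψ k′ , w) ∈E blue c → k ≡ k′
    blue-star-disjoint w w∉image k k′ ψk-w∈ ψk′-w∈ = ψ-injective (dom k) (dom k′)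
      (blue-functional (blue-leaving w∉image ψk-w∈) (blue-leaving w∉image ψk′-w∈) refl)

    blue-star-size : ∀ k → blueOut F ρ ψ c (ψ k) ≤ deg F k
    blue-star-size k = begin
      blueOut F ρ ψ c (ψ k)                ≤⟨ Unique-⊆⇒length≤ (Unique.filter⁺ _ (Unique.allFin⁺ N))
                                                                   (target ∘ ∈-filter⁻ _) ⟩
      length (map proj₂ (startsAt (ψ k)))  ≡⟨ length-map proj₂ (startsAt (ψ k)) ⟩
      outdeg (ψ k) (blue c)                ≤⟨ blue-outdeg (dom k) ⟩
      children F k                         ≤⟨ children≤deg k ⟩
      deg F k                              ∎
      where
        open ≤-Reasoning
        startsAt : Fin N → List (Pair N)
        startsAt u = filter (λ e → proj₁ e ≟ u) (blue c)

        target : ∀ {w} → w ∈ allFin N × ¬ InImage F ρ ψ w × (ψ k , w) ∈E blue c →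
                 w ∈ map proj₂ (startsAt (ψ k))
        target (_ , w∉image , ψk-w∈) = ∈-map⁺ proj₂ (∈-filter⁺ _ (blue-leaving w∉image ψk-w∈) refl)

    goodCopy : GoodCopy F ρ c
    goodCopy = ψ
             , (λ i j → ψ-injective (dom i) (dom j))
             , (λ i j i-child → Any.map (λ { refl → inj₂ (refl , refl) })
                                         (red-tree (∈-allFin i) i-child))
             , ψ-root
             , coloured-at-nonLeaf
             , blue-star-disjoint
             , blue-star-size

  play : ∀ {pre} todo {c} → PartialCopy pre todo c → WaiterForces (GoodCopy F ρ) (nonRoots todo) c
  play {pre} [] {c} inv = stop (Complete.goodCopy (subst (λ l → PartialCopy l [] c) pre≡allFin inv))
    where
      pre≡allFin : pre ≡ allFin n
      pre≡allFin = trans (sym (++-identityʳ pre)) (PartialCopy.split inv)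
  play (x ∷ xs) inv with isRoot? x
  ... | yes root   = play xs (extendByRoot inv root)
  ... | no nonRoot = forces-bind (Extend.round inv (proj₂ (nonRoot⇒∃parent nonRoot))) (play xs)

lemma3p20 : ∀ {n} (F : RootedForest n) (N : ℕ) → vF F + eF F ≤ N →
            (ρ : Fin n → Fin N) →
            (∀ i j → IsRoot F i → IsRoot F j → ρ i ≡ ρ j → i ≡ j) →
            WaiterForces (GoodCopy F ρ) (eF F) emptyColouring
lemma3p20 {n} F N fits ρ ρ-injective = play (allFin n) (initial fits ρ-injective)
  where open Strategy F ρ
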